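{- Let $\theta$ be a type of shape $S$ and let $a$ be a dominant row of $\theta$. Then for every tableau $T=(t_{\mathfrak c})\in\mathrm{Tab}(\theta)$ and every $(a,y)\in S$ we have $t_{a,y}>t_{a+1,y}$.
   Context: A diagram is a finite subset $S\subset\mathbb N_{>0}^2$; $(a,b)$ is the box in row $a$ (top to bottom), column $b$. Arm $A_S(a,b)=\{(a,k)\in S:k>b\}$, leg $L_S(a,b)=\{(k,b)\in S:k\ge a\}$, hook $H_S=A_S\cup L_S$, $h_S=|H_S|$. A tableau of shape $S$ ($|S|=n$) is a bijection $t:S\to\{1,\dots,n\}$. A type of shape $S$ is a map $\theta:S\to\mathbb Z$ with $0\le\theta\le h_S-1$. The type of a tableau $T$ is $\mathfrak c\mapsto|\{\mathfrak d\in H_S(\mathfrak c):t_{\mathfrak d}<t_{\mathfrak c}\}|$; $\mathrm{Tab}(\theta)$ is the set of tableaux of shape $S$ of type $\theta$. Row $a$ is dominant in $\theta$ if for every $(a,y)\in S$ we have $(a+1,y)\in S$ and $\theta(a,y)>\theta(a+1,y)$. -}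

module Defs where

open import Data.Nat using (ℕ; suc; _<_; _≤_; _<?_; _≤?_)
open import Data.Nat.Properties using (_≟_)
open import Data.Integer using (ℤ; +_; _-_) renaming (_≤_ to _≤ℤ_; _<_ to _<ℤ_)
open import Data.Product using (_×_; _,_; Σ; ∃)
open import Data.Sum using (_⊎_)
open import Data.List using (List; length; filter)
open import Data.List.Membership.Propositional using (_∈_)
open import Data.List.Relation.Unary.Unique.Propositional using (Unique)
open import Data.List.Relation.Unary.All using (All)
open import Relation.Binary.PropositionalEquality using (_≡_)
open import Relation.Nullary using (Dec)
open import Relation.Nullary.Decidable using (_×-dec_; _⊎-dec_)

-- A box (a , b): row a, column b.
Box : Set
Box = ℕ × ℕ

record Diagram : Set where
  constructor mkDiagram
  field
    boxes    : List Box
    unique   : Unique boxes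
    positive : All (λ c → 1 ≤ Data.Product.proj₁ c × 1 ≤ Data.Product.proj₂ c) boxes
open Diagram public

-- d lies in the hook of c = (a , b) (ignoring membership in S):
-- arm: d = (a , k) with k > b;  leg: d = (k , b) with k ≥ a.
InHook : Box → Box → Set
InHook (a , b) (i , j) = (i ≡ a × b < j) ⊎ (j ≡ b × a ≤ i)

inHook? : (c d : Box) → Dec (InHook c d)
inHook? (a , b) (i , j) = ((i ≟ a) ×-dec (b <? j)) ⊎-dec ((j ≟ b) ×-dec (a ≤? i))

hookList : Diagram → Box → List Box
hookList S c = filter (inHook? c) (boxes S)

hookLen : Diagram → Box → ℕ
hookLen S c = length (hookList S c)

size : Diagram → ℕ
size S = length (boxes S)

-- A tableau of shape S: a function on boxes whose restriction to S is a
-- bijection S → {1,…,n} (values outside S are irrelevant).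
IsTableau : Diagram → (Box → ℕ) → Set
IsTableau S t =
  (∀ {c} → c ∈ boxes S → 1 ≤ t c × t c ≤ size S)
  × (∀ {c d} → c ∈ boxes S → d ∈ boxes S → t c ≡ t d → c ≡ d)
  × (∀ k → 1 ≤ k → k ≤ size S → Σ Box (λ c → c ∈ boxes S × t c ≡ k))

IsType : Diagram → (Box → ℤ) → Set
IsType S θ = ∀ {c} → c ∈ boxes S → (+ 0 ≤ℤ θ c) × (θ c ≤ℤ (+ hookLen S c) - + 1)

typeOf : Diagram → (Box → ℕ) → Box → ℕ
typeOf S t c = length (filter (λ d → t d <? t c) (hookList S c))

InTab : Diagram → (Box → ℤ) → (Box → ℕ) → Set
InTab S θ t = IsTableau S t × (∀ {c} → c ∈ boxes S → θ c ≡ + typeOf S t c)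

Dominant : Diagram → (Box → ℤ) → ℕ → Set
Dominant S θ a = ∀ y → (a , y) ∈ boxes S →
  ((suc a , y) ∈ boxes S) × (θ (suc a , y) <ℤ θ (a , y))

-- Compare the two boxes c = (a , y) and d = (a + 1 , y), working through row a from right to left.
-- If t_c < t_d, every box counted by the type at c is also counted at d after pushing arm
-- boxes one row down: (a , k) ↦ (a + 1 , k) stays below t_c by induction on the column, and
-- leg boxes strictly below c lie in the leg of d. So θ(c) ≤ θ(d), against dominance.
module Submission where

open import Defs
open import Data.Nat using (ℕ; zero; suc; _<_; _≤_; _+_; z≤n; s≤s; _<?_)
open import Data.Nat.Properties
open import Data.Integer using (ℤ) renaming (_<_ to _<ℤ_)
open import Data.Integer.Properties using (drop‿+<+)
open import Data.Product using (_,_; _×_; proj₁; proj₂)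
open import Data.Product.Properties using (≡-dec)
open import Data.Sum using (inj₁; inj₂)
open import Data.List using (List; []; _∷_; length; filter; map)
open import Data.List.Extrema.Nat using (max; xs≤max)
import Data.List.Relation.Unary.All as All
open import Data.List.Relation.Unary.AllPairs using (_∷_)
open import Data.List.Relation.Unary.Any as Any using (here; there)
open import Data.List.Relation.Unary.Unique.Propositional using (Unique)
import Data.List.Relation.Unary.Unique.Propositional.Properties as Unique
open import Data.List.Properties using (filter-notAll)
open import Data.List.Membership.Propositional using (_∈_)
open import Data.List.Membership.Propositional.Properties using (∈-filter⁺; ∈-filter⁻; ∈-map⁺)
open import Function.Definitions using (Injective)
open import Relation.Binary.Definitions using (DecidableEquality)
open import Relation.Binary.PropositionalEquality
open import Relation.Nullary using (¬_; ¬?; yes; no)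
open import Relation.Unary using (Decidable)
open import Relation.Nullary.Negation using (contradiction)

length-≤-of-injection : {A B : Set} → DecidableEquality B → (f : A → B) → Injective _≡_ _≡_ f →
  {xs : List A} {ys : List B} → Unique xs → (∀ {x} → x ∈ xs → f x ∈ ys) →
  length xs ≤ length ys
length-≤-of-injection _≟ᴮ_ f f-inj {[]} _ _ = z≤n
length-≤-of-injection _≟ᴮ_ f f-inj {x ∷ xs} {ys} (x∉xs ∷ xs-unique) xs↦ys =
  ≤-trans (s≤s (length-≤-of-injection _≟ᴮ_ f f-inj xs-unique xs↦ys-fx))
          (filter-notAll keep ys (Any.map (λ eq ≢fx → ≢fx (sym eq)) (xs↦ys (here refl))))
  where
  keep : Decidable (λ z → ¬ z ≡ f x)
  keep z = ¬? (z ≟ᴮ f x)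
  xs↦ys-fx : ∀ {z} → z ∈ xs → f z ∈ filter keep ys
  xs↦ys-fx z∈xs = ∈-filter⁺ keep (xs↦ys (there z∈xs))
    (λ fz≡fx → All.lookup x∉xs z∈xs (sym (f-inj fz≡fx)))

bounded-downward-induction : (P : ℕ → Set) (bound : ℕ) →
  (∀ {y} → bound < y → P y) → (∀ {y} → (∀ {k} → y < k → P k) → P y) → ∀ y → P y
bounded-downward-induction P bound above step y = go (suc bound) y (m≤m+n (suc bound) y)
  where
  go : ∀ fuel y → bound < fuel + y → P y
  go zero y bound<y = above bound<y
  go (suc fuel) y bound<fuel+y = step λ {k} y<k →
    go fuel k (<-≤-trans bound<fuel+y (≤-trans (≤-reflexive (sym (+-suc fuel y))) (+-monoʳ-≤ fuel y<k)))

maxColumn : Diagram → ℕ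
maxColumn S = max 0 (map proj₂ (boxes S))

column≤maxColumn : (S : Diagram) → ∀ {c} → c ∈ boxes S → proj₂ c ≤ maxColumn S
column≤maxColumn S c∈S = All.lookup (xs≤max 0 (map proj₂ (boxes S))) (∈-map⁺ proj₂ c∈S)

hookBelow : Diagram → (Box → ℕ) → Box → List Box
hookBelow S t c = filter (λ d → t d <? t c) (hookList S c)

hookBelow-unique : (S : Diagram) (t : Box → ℕ) (c : Box) → Unique (hookBelow S t c)
hookBelow-unique S t c = Unique.filter⁺ _ (Unique.filter⁺ _ (unique S))

∈-hookBelow⁻ : (S : Diagram) (t : Box → ℕ) (c : Box) → ∀ {d} → d ∈ hookBelow S t c →
  d ∈ boxes S × InHook c d × t d < t c
∈-hookBelow⁻ S t c d∈ with ∈-filter⁻ (λ d → t d <? t c) d∈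
... | d∈hook , td<tc with ∈-filter⁻ (inHook? c) d∈hook
... | d∈S , inHook = d∈S , inHook , td<tc

∈-hookBelow⁺ : (S : Diagram) (t : Box → ℕ) (c : Box) → ∀ {d} →
  d ∈ boxes S → InHook c d → t d < t c → d ∈ hookBelow S t c
∈-hookBelow⁺ S t c d∈S inHook td<tc =
  ∈-filter⁺ (λ d → t d <? t c) (∈-filter⁺ (inHook? c) d∈S inHook) td<tc

shiftOffColumn : ℕ → Box → Box
shiftOffColumn y (i , j) with j ≟ y
... | yes _ = (i , j)
... | no _ = (suc i , j)

shiftOffColumn-injective : ∀ y → Injective _≡_ _≡_ (shiftOffColumn y)
shiftOffColumn-injective y {i , j} {i' , j'} eq with j ≟ y | j' ≟ y
... | yes _ | yes _ = eq
... | no _ | no _ = cong₂ _,_ (suc-injective (cong proj₁ eq)) (cong proj₂ eq)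
... | yes j≡y | no j'≢y = contradiction (trans (sym (cong proj₂ eq)) j≡y) j'≢y
... | no j≢y | yes j'≡y = contradiction (trans (cong proj₂ eq) j'≡y) j≢y

typeOf-≤-below : (S : Diagram) (t : Box → ℕ) (a y : ℕ) →
  (∀ {k} → y < k → (a , k) ∈ boxes S → (suc a , k) ∈ boxes S × t (suc a , k) < t (a , k)) →
  t (a , y) < t (suc a , y) → typeOf S t (a , y) ≤ typeOf S t (suc a , y)
typeOf-≤-below S t a y armDescends tc<td =
  length-≤-of-injection (≡-dec _≟_ _≟_) (shiftOffColumn y) (shiftOffColumn-injective y)
    (hookBelow-unique S t (a , y)) maps
  where
  maps : ∀ {z} → z ∈ hookBelow S t (a , y) → shiftOffColumn y z ∈ hookBelow S t (suc a , y)
  maps {i , j} z∈ with ∈-hookBelow⁻ S t (a , y) z∈ | j ≟ y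
  ... | _ , inj₁ (refl , y<j) , _ | yes j≡y = contradiction (sym j≡y) (<⇒≢ y<j)
  ... | z∈S , inj₁ (refl , y<j) , tz<tc | no _ =
    ∈-hookBelow⁺ S t (suc a , y) (proj₁ (armDescends y<j z∈S)) (inj₁ (refl , y<j))
      (<-trans (proj₂ (armDescends y<j z∈S)) (<-trans tz<tc tc<td))
  ... | _ , inj₂ (refl , _) , _ | no j≢y = contradiction refl j≢y
  ... | z∈S , inj₂ (refl , a≤i) , tz<tc | yes _ with a ≟ i
  ...   | yes refl = contradiction tz<tc (<-irrefl refl)
  ...   | no a≢i = ∈-hookBelow⁺ S t (suc a , y) z∈S (inj₂ (refl , ≤∧≢⇒< a≤i a≢i)) (<-trans tz<tc tc<td)

descends-at : (S : Diagram) (θ : Box → ℤ) (a : ℕ) → Dominant S θ a →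
  (t : Box → ℕ) → InTab S θ t → ∀ {y} → (a , y) ∈ boxes S →
  (∀ {k} → y < k → (a , k) ∈ boxes S → t (suc a , k) < t (a , k)) →
  t (suc a , y) < t (a , y)
descends-at S θ a dom t (isTableau , typed) {y} c∈S armDescends
  with d∈S , θd<θc ← dom y c∈S | t (a , y) <? t (suc a , y)
... | no tc≮td = ≤∧≢⇒< (≮⇒≥ tc≮td) (λ td≡tc → 1+n≢n (cong proj₁ (t-injective d∈S c∈S td≡tc)))
  where
  t-injective : ∀ {c d} → c ∈ boxes S → d ∈ boxes S → t c ≡ t d → c ≡ d
  t-injective = proj₁ (proj₂ isTableau)
... | yes tc<td = contradiction
  (typeOf-≤-below S t a y (λ y<k k∈S → proj₁ (dom _ k∈S) , armDescends y<k k∈S) tc<td)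
  (<⇒≱ (drop‿+<+ (subst₂ _<ℤ_ (typed d∈S) (typed c∈S) θd<θc)))

mainTheorem8 : (S : Diagram) (θ : Box → ℤ) → IsType S θ → (a : ℕ) → Dominant S θ a →
    (t : Box → ℕ) → InTab S θ t →
    ∀ y → (a , y) ∈ boxes S → t (suc a , y) < t (a , y)
mainTheorem8 S θ _ a dom t tab =
  bounded-downward-induction (λ y → (a , y) ∈ boxes S → t (suc a , y) < t (a , y)) (maxColumn S)
    (λ beyond c∈S → contradiction (column≤maxColumn S c∈S) (<⇒≱ beyond))
    (λ armDescends c∈S → descends-at S θ a dom t tab c∈S armDescends)
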